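{- There exist a satisfaction system $\Lambda=(\mathcal{L},\mathfrak{M},\models)$, a set of models $\mathbb{M}\subseteq\mathfrak{M}$ and a family $\mathcal{M}\subseteq\mathrm{FRsups}(\mathbb{M},\Lambda)$ with $|\mathcal{M}|\geq 2$ such that $\bigcup_{X\in\mathcal{M}}X\notin\mathrm{FR}(\Lambda)$. (That is, the union of two or more $\subseteq$-minimal finitely representable supersets of a set of models is not necessarily finitely representable.)
   Context: A satisfaction system is a triple $\Lambda=(\mathcal{L},\mathfrak{M},\models)$ where $\mathcal{L}$ is a set of formulae, $\mathfrak{M}$ a set of models, and $\models$ a relation between models and sets of formulae $B\subseteq\mathcal{L}$. $\mathrm{Mod}(B)=\{m\in\mathfrak{M}\mid m\models B\}$. $\mathrm{FR}(\Lambda)=\{X\subseteq\mathfrak{M}\mid X=\mathrm{Mod}(B)$ for some finite $B\subseteq\mathcal{L}\}$. For $\mathbb{M}\subseteq\mathfrak{M}$, $\mathrm{FRsups}(\mathbb{M},\Lambda)=\{X\in\mathrm{FR}(\Lambda)\mid \mathbb{M}\subseteq X$ and there is no $Y\in\mathrm{FR}(\Lambda)$ with $\mathbb{M}\subseteq Y\subsetneq X\}$. -}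

module Defs where

open import Level using (Level; _⊔_; 0ℓ) renaming (suc to lsuc)
open import Data.List using (List)
open import Data.List.Membership.Propositional using (_∈_)
open import Data.Product using (Σ; ∃; _×_; _,_)
open import Relation.Nullary using (¬_)
open import Relation.Unary using (Pred; _⊆_; _⊂_; _≐_)

record SatSystem : Set₁ where
  field
    Form  : Set
    Model : Set
    _⊨_   : Model → Pred Form 0ℓ → Set

module _ (Λ : SatSystem) where
  open SatSystem Λ

  Mod : Pred Form 0ℓ → Pred Model 0ℓ
  Mod B m = m ⊨ B

  ⟦_⟧ : List Form → Pred Form 0ℓ
  ⟦ xs ⟧ φ = φ ∈ xs

  FR : ∀ {ℓ} → Pred (Pred Model ℓ) ℓ
  FR X = ∃ λ (xs : List Form) → X ≐ Mod ⟦ xs ⟧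

  FRsups : Pred Model 0ℓ → Pred (Pred Model 0ℓ) (lsuc 0ℓ)
  FRsups 𝕄 X = FR X × 𝕄 ⊆ X ×
    ¬ (Σ (Pred Model 0ℓ) λ Y → FR Y × 𝕄 ⊆ Y × Y ⊂ X)

  ⋃ : Pred (Pred Model 0ℓ) 0ℓ → Pred Model (lsuc 0ℓ)
  ⋃ 𝓜 m = Σ (Pred Model 0ℓ) λ X → 𝓜 X × X m

{-# OPTIONS --safe #-}
module Submission where

-- Let a model b ∈ Bool satisfy a set B of formulae iff (true ∈ B ⇔ b ≡ true).
-- Then Mod(B) is a singleton for every B, so the finitely representable sets
-- are exactly the two singletons. They are ⊆-incomparable, hence each is a
-- minimal finitely representable superset of ∅, while their union contains
-- two models and so is not a singleton.

open import Defs
open import Level using (0ℓ)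
open import Data.Bool using (Bool; true; false)
open import Data.Bool.Properties using () renaming (_≟_ to _≟ᵇ_)
open import Data.Empty using (⊥-elim)
open import Data.List using ([]; _∷_)
open import Data.List.Membership.DecPropositional _≟ᵇ_ using (_∈?_)
open import Data.Product using (Σ; ∃; _×_; _,_)
open import Function.Bundles using (_⇔_; mk⇔; Equivalence)
open import Relation.Binary.PropositionalEquality using (_≡_; refl; sym; trans)
open import Relation.Nullary using (¬_; yes; no; isYes)
open import Relation.Unary using (Pred; ∅; ｛_｝; _⊆_; _≐_)
open import Relation.Unary.Properties using (≐-sym; ≐-trans)

open Equivalence using (to; from)

module _ (Λ : SatSystem) where
  open SatSystem Λ

  FR-antichain⇒FR⊆FRsups-∅ :
    (∀ {X Y : Pred Model 0ℓ} → FR Λ X → FR Λ Y → Y ⊆ X → X ⊆ Y) →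
    FR Λ ⊆ FRsups Λ ∅
  FR-antichain⇒FR⊆FRsups-∅ antichain FR-X =
    FR-X , (λ ()) , λ (_ , FR-Y , _ , Y⊆X , X⊈Y) → X⊈Y (antichain FR-X FR-Y Y⊆X)

Λ₀ : SatSystem
Λ₀ = record { Form = Bool ; Model = Bool ; _⊨_ = λ m B → B true ⇔ m ≡ true }

Mod-⟦⟧≐｛｝ : ∀ xs → Mod Λ₀ (⟦ Λ₀ ⟧ xs) ≐ ｛ isYes (true ∈? xs) ｝
Mod-⟦⟧≐｛｝ xs with true ∈? xs
... | yes true∈xs = (λ m⊨xs → sym (to m⊨xs true∈xs))
                  , (λ { refl → mk⇔ (λ _ → refl) (λ _ → true∈xs) })
... | no true∉xs = (λ { {false} _ → refl ; {true} m⊨xs → ⊥-elim (true∉xs (from m⊨xs refl)) })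
                 , (λ { refl → mk⇔ (λ true∈xs → ⊥-elim (true∉xs true∈xs)) (λ ()) })

FR-｛｝ : ∀ b → FR Λ₀ ｛ b ｝
FR-｛｝ true  = true ∷ [] , ≐-sym (Mod-⟦⟧≐｛｝ (true ∷ []))
FR-｛｝ false = []        , ≐-sym (Mod-⟦⟧≐｛｝ [])

FR⇒≐｛｝ : ∀ {ℓ} {X : Pred Bool ℓ} → FR Λ₀ X → ∃ λ b → X ≐ ｛ b ｝
FR⇒≐｛｝ (xs , X≐Mod) = _ , ≐-trans X≐Mod (Mod-⟦⟧≐｛｝ xs)

FR-antichain : ∀ {X Y : Pred Bool 0ℓ} → FR Λ₀ X → FR Λ₀ Y → Y ⊆ X → X ⊆ Y
FR-antichain FR-X FR-Y Y⊆X {x} x∈X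
  with FR⇒≐｛｝ FR-X | FR⇒≐｛｝ FR-Y
... | b , X⊆｛b｝ , _ | c , _ , ｛c｝⊆Y =
  ｛c｝⊆Y (trans (sym (X⊆｛b｝ (Y⊆X (｛c｝⊆Y refl)))) (X⊆｛b｝ x∈X))

FR-true⇒false∉ : ∀ {ℓ} {X : Pred Bool ℓ} → FR Λ₀ X → X true → ¬ X false
FR-true⇒false∉ FR-X true∈X false∈X with FR⇒≐｛｝ FR-X
... | _ , X⊆｛b｝ , _ = true≢false (trans (sym (X⊆｛b｝ true∈X)) (X⊆｛b｝ false∈X))
  where
  true≢false : ¬ true ≡ false
  true≢false ()

proposition3 : Σ SatSystem λ Λ → Σ (Pred (SatSystem.Model Λ) 0ℓ) λ 𝕄 → Σ (Pred (Pred (SatSystem.Model Λ) 0ℓ) 0ℓ) λ 𝓜 →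
    𝓜 ⊆ FRsups Λ 𝕄
    × Σ (Pred (SatSystem.Model Λ) 0ℓ) (λ X → Σ (Pred (SatSystem.Model Λ) 0ℓ) λ Y → 𝓜 X × 𝓜 Y × ¬ (X ≐ Y))
    × ¬ FR Λ (⋃ Λ 𝓜)
proposition3 =
  Λ₀ , ∅ , FR Λ₀ ,
  FR-antichain⇒FR⊆FRsups-∅ Λ₀ FR-antichain ,
  (｛ true ｝ , ｛ false ｝ , FR-｛｝ true , FR-｛｝ false , λ (｛true｝⊆｛false｝ , _) → false≢true (｛true｝⊆｛false｝ refl)) ,
  λ FR-⋃ → FR-true⇒false∉ FR-⋃ (_ , FR-｛｝ true , refl) (_ , FR-｛｝ false , refl)
  where
  false≢true : ¬ false ≡ true
  false≢true ()
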